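{- The automorphism group of any connected component of $H_{\aleph_0}$ is isomorphic to the weak wreath product $S_2\wr_w S_{\aleph_0}$.
   Context: A subset $X\subset\mathbb{Z}\setminus\{0\}$ is called singular if $i\in X$ implies $-i\notin X$; a maximal singular subset is one containing exactly one of $i,-i$ for every natural $i$. Two maximal singular subsets $X,Y$ are adjacent if $|X\setminus Y|=|Y\setminus X|=1$. The graph $H_{\aleph_0}$ has as vertices all maximal singular subsets of $\mathbb{Z}\setminus\{0\}$ and as edges the adjacent pairs. $S_\alpha$ denotes the group of all permutations of a set of cardinality $\alpha$ ($S_2$ acting on a 2-element set, $S_{\aleph_0}$ on a countably infinite set). For permutation groups $G_1$ on $X_1$ and $G_2$ on $X_2$, the wreath product $G_1\wr G_2$ is the permutation group on $X_1\times X_2$ generated by (1) for each $g\in G_2$, the permutation $(x_1,x_2)\mapsto(x_1,g(x_2))$, and (2) for each function $i:X_2\to G_1$, the permutation $(x_1,x_2)\mapsto(i(x_2)x_1,x_2)$. The weak wreath product $G_1\wr_w G_2$ is the subgroup generated by all permutations of type (1) together with those permutations of type (2) for which $\{x_2\in X_2: i(x_2)\neq \mathrm{id}_{X_1}\}$ is finite. -}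

module Defs where

open import Level using (0ℓ)
open import Data.Bool using (Bool)
open import Data.Nat using (ℕ; _≥_)
open import Data.Product using (Σ; _×_; _,_; proj₁; proj₂; ∃)
open import Relation.Binary using (Setoid; Rel)
open import Relation.Binary.PropositionalEquality as ≡ using (_≡_; _≢_)
open import Relation.Binary.Construct.Closure.ReflexiveTransitive using (Star)
open import Function.Bundles using (Inverse; _↔_; _⇔_; mk⇔)
open import Data.Product.Function.NonDependent.Propositional using (_×-↔_)
import Function.Construct.Composition as Comp
import Function.Construct.Identity as Ident
import Function.Construct.Symmetry as Sym
open import Algebra.Bundles using (Group)
open import Algebra.Morphism.Structures using (module GroupMorphisms)

-- A maximal singular subset X of ℤ∖{0} contains exactly one of i, -i for
-- every natural i ≥ 1.  We encode it by the function  ℕ → Bool  sending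
-- k to  true  if  k+1 ∈ X  and to  false  if  -(k+1) ∈ X.  This is a
-- bijective encoding of the vertex set of H_{ℵ₀}.  Two vertices are equal
-- (as sets) iff the encoding functions agree pointwise.

Vertex : Set
Vertex = ℕ → Bool

-- |X ∖ Y| = |Y ∖ X| = 1  ⟺  the encodings differ in exactly one coordinate.
Adjacent : Rel Vertex 0ℓ
Adjacent X Y = Σ ℕ λ i → (X i ≢ Y i) × (∀ j → j ≢ i → X j ≡ Y j)

Connected : Rel Vertex 0ℓ
Connected = Star Adjacent

_≐_ : Rel Vertex 0ℓ
X ≐ Y = ∀ i → X i ≡ Y i

Adjacent-resp : ∀ {X X′ Y Y′} → X ≐ X′ → Y ≐ Y′ → Adjacent X Y → Adjacent X′ Y′
Adjacent-resp {X} {X′} {Y} {Y′} eX eY (i , d , s) =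
  i , (λ e → d (≡.trans (eX i) (≡.trans e (≡.sym (eY i)))))
    , λ j j≢i → ≡.trans (≡.sym (eX j)) (≡.trans (s j j≢i) (eY j))

Component : Vertex → Setoid 0ℓ 0ℓ
Component X₀ = record
  { Carrier = Σ Vertex (Connected X₀)
  ; _≈_ = λ u v → proj₁ u ≐ proj₁ v
  ; isEquivalence = record
    { refl = λ i → ≡.refl
    ; sym = λ e i → ≡.sym (e i)
    ; trans = λ e f i → ≡.trans (e i) (f i)
    }
  }

-- Group operation:  f ∙ g = f ∘ g  (apply g first); equality is pointwise.

module PermutationSubgroup
  (S : Setoid 0ℓ 0ℓ) (P : Inverse S S → Set)
  (P-id : P (Ident.inverse S))
  (P-∘ : ∀ f g → P f → P g → P (Comp.inverse g f))
  (P-⁻¹ : ∀ f → P f → P (Sym.inverse f)) where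

  open Setoid S renaming (Carrier to A)
  open Inverse

  Elt : Set
  Elt = Σ (Inverse S S) P

  _≋_ : Rel Elt 0ℓ
  (f , _) ≋ (g , _) = ∀ x → to f x ≈ to g x

  _∙_ : Elt → Elt → Elt
  (f , p) ∙ (g , q) = Comp.inverse g f , P-∘ f g p q

  e : Elt
  e = Ident.inverse S , P-id

  _⁻¹ : Elt → Elt
  (f , p) ⁻¹ = Sym.inverse f , P-⁻¹ f p

  group : Group 0ℓ 0ℓ
  group = record
    { Carrier = Elt
    ; _≈_ = _≋_
    ; _∙_ = _∙_
    ; ε = e
    ; _⁻¹ = _⁻¹
    ; isGroup = record
      { isMonoid = record
        { isSemigroup = record
          { isMagma = record
            { isEquivalence = record
              { refl = λ x → refl
              ; sym = λ a x → sym (a x)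
              ; trans = λ a b x → trans (a x) (b x)
              }
            ; ∙-cong = λ { {f , _} {f′ , _} {g , _} {g′ , _} a b x →
                trans (to-cong f (b x)) (a (to g′ x)) }
            }
          ; assoc = λ _ _ _ x → refl
          }
        ; identity = (λ _ x → refl) , (λ _ x → refl)
        }
      ; inverse = (λ { (f , _) x → strictlyInverseʳ f x })
                , (λ { (f , _) x → strictlyInverseˡ f x })
      ; ⁻¹-cong = λ { {f , _} {g , _} a x →
          trans (from-cong f (sym (strictlyInverseˡ g x)))
            (trans (from-cong f (sym (a (from g x))))
              (strictlyInverseʳ f (from g x))) }
      }
    }

IsAutomorphism : (X₀ : Vertex) → Inverse (Component X₀) (Component X₀) → Set
IsAutomorphism X₀ f =
  ∀ u v → Adjacent (proj₁ u) (proj₁ v) ⇔ Adjacent (proj₁ (to u)) (proj₁ (to v))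
  where open Inverse f

private
  aut-id : ∀ X₀ → IsAutomorphism X₀ (Ident.inverse (Component X₀))
  aut-id X₀ u v = mk⇔ (λ a → a) (λ a → a)

  aut-∘ : ∀ X₀ f g → IsAutomorphism X₀ f → IsAutomorphism X₀ g →
          IsAutomorphism X₀ (Comp.inverse g f)
  aut-∘ X₀ f g p q u v =
    mk⇔ (λ a → Equivalence.to (p _ _) (Equivalence.to (q u v) a))
        (λ a → Equivalence.from (q u v) (Equivalence.from (p _ _) a))
    where open Function.Bundles using (Equivalence)

  aut-⁻¹ : ∀ X₀ f → IsAutomorphism X₀ f → IsAutomorphism X₀ (Sym.inverse f)
  aut-⁻¹ X₀ f p u v =
    mk⇔ (λ a → Equivalence.from (p (from u) (from v))
                 (Adjacent-resp (λ i → ≡.sym (strictlyInverseˡ u i))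
                                (λ i → ≡.sym (strictlyInverseˡ v i)) a))
        (λ a → Adjacent-resp (strictlyInverseˡ u) (strictlyInverseˡ v)
                 (Equivalence.to (p (from u) (from v)) a))
    where
    open Inverse f
    open Function.Bundles using (Equivalence)

AutGroup : Vertex → Group 0ℓ 0ℓ
AutGroup X₀ =
  PermutationSubgroup.group (Component X₀) (IsAutomorphism X₀)
    (aut-id X₀) (aut-∘ X₀) (aut-⁻¹ X₀)

-- The weak wreath product S₂ ≀_w S_{ℵ₀}, as a permutation group on
-- Bool × ℕ  (X₁ = Bool, a 2-element set;  X₂ = ℕ, a countably infinite set).

Perm : Set → Set
Perm A = A ↔ A

type₁ : Perm ℕ → Perm (Bool × ℕ)
type₁ g = Ident.↔-id Bool ×-↔ g

type₂ : (ℕ → Perm Bool) → Perm (Bool × ℕ)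
type₂ i = record
  { to = λ { (b , n) → Inverse.to (i n) b , n }
  ; from = λ { (b , n) → Inverse.from (i n) b , n }
  ; to-cong = ≡.cong _
  ; from-cong = ≡.cong _
  ; inverse = (λ { {b , n} ≡.refl → ≡.cong (_, n) (Inverse.strictlyInverseˡ (i n) b) })
            , (λ { {b , n} ≡.refl → ≡.cong (_, n) (Inverse.strictlyInverseʳ (i n) b) })
  }

-- {x₂ ∈ ℕ : i(x₂) ≠ id} is finite (equivalently, bounded in ℕ).
FiniteSupport : (ℕ → Perm Bool) → Set
FiniteSupport i = ∃ λ N → ∀ n → n ≥ N → ∀ b → Inverse.to (i n) b ≡ b

data InWeakWreath : Perm (Bool × ℕ) → Set where
  gen₁  : ∀ g → InWeakWreath (type₁ g)
  gen₂  : ∀ i → FiniteSupport i → InWeakWreath (type₂ i)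
  g-id  : InWeakWreath (Ident.↔-id (Bool × ℕ))
  g-∘   : ∀ f g → InWeakWreath f → InWeakWreath g → InWeakWreath (Comp.inverse g f)
  g-⁻¹  : ∀ f → InWeakWreath f → InWeakWreath (Sym.inverse f)

WeakWreathS₂Sℵ₀ : Group 0ℓ 0ℓ
WeakWreathS₂Sℵ₀ =
  PermutationSubgroup.group (≡.setoid (Bool × ℕ)) InWeakWreath g-id g-∘ g-⁻¹

_≅ᴳ_ : Group 0ℓ 0ℓ → Group 0ℓ 0ℓ → Set
G ≅ᴳ H = Σ (Group.Carrier G → Group.Carrier H)
           (GroupMorphisms.IsGroupIsomorphism (Group.rawGroup G) (Group.rawGroup H))

module Submission where

-- An edge of H_{ℵ₀} toggles one coordinate.  An automorphism F of the component of X₀ sends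
-- the edge of u in direction i to an edge of F u in some direction; comparing the images of
-- the two paths around a 4-cycle shows that this direction σ i does not depend on u.  Hence,
-- in coordinates relative to X₀, F u is u ∘ σ⁻¹ shifted by the finite set t = X₀ ⊕ F X₀
-- (translation F), and F ↦ ((b , k) ↦ (t (σ k) xor b , σ k)) is an injective homomorphism into
-- S₂ ≀_w S_{ℵ₀}.  Every element of the weak wreath product has this shape with t finitely
-- supported, and the corresponding affine map of the hypercube preserves the component,
-- so the homomorphism is onto.

open import Defs

open import Data.Bool using (Bool; true; false; not; _xor_)
open import Data.Bool.Properties
  using (not-involutive; not-¬; ¬-not; xor-same; xor-assoc; xor-comm; xor-identityʳ)
import Data.Bool.Properties as Bool
open import Data.Nat using (ℕ; zero; suc; z≤n; _<_; _≥_; _⊔_)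
open import Data.Nat.Properties
  using (_≟_; ≤-trans; m≤m⊔n; m≤n⊔m; m<1+n⇒m<n∨m≡n; ≤∧≢⇒<; ≮⇒≥; <⇒≱; <-irrefl)
open import Data.Product using (_×_; _,_; proj₁; proj₂; ∃)
open import Data.Sum using ([_,_])
open import Data.Empty using (⊥-elim)
open import Function using (_∘_)
import Function.Construct.Composition as Comp
import Function.Construct.Identity as Ident
import Function.Construct.Symmetry as Sym
open import Function.Bundles using (Inverse; Injection; Equivalence; mk↔ₛ′; mk⇔)
open import Function.Properties.Inverse using (Inverse⇒Injection)
open import Relation.Binary using (Setoid)
open import Algebra.Bundles using (Group)
open import Relation.Nullary using (yes; no; does)
open import Relation.Nullary.Decidable using (dec-true; dec-false)
open import Relation.Binary.PropositionalEquality
  using (_≡_; _≢_; refl; sym; trans; cong; cong₂; subst; module ≡-Reasoning)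
open ≡-Reasoning
open import Relation.Binary.Construct.Closure.ReflexiveTransitive
  using (Star; ε; _◅_; _◅◅_; gmap; reverse)

xor-cancelˡ : ∀ x y → x xor (x xor y) ≡ y
xor-cancelˡ false y = refl
xor-cancelˡ true  y = not-involutive y

xor-cancelʳ : ∀ x y → (x xor y) xor y ≡ x
xor-cancelʳ x y = trans (xor-assoc x y y) (trans (cong (x xor_) (xor-same y)) (xor-identityʳ x))

xor-swap : ∀ x y z → x xor (y xor z) ≡ y xor (x xor z)
xor-swap x y z = trans (sym (xor-assoc x y z)) (trans (cong (_xor z) (xor-comm x y)) (xor-assoc y x z))

xor-injective : ∀ x {y z} → x xor y ≡ x xor z → y ≡ z
xor-injective x {y} {z} e = trans (sym (xor-cancelˡ x y)) (trans (cong (x xor_) e) (xor-cancelˡ x z))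

infixl 30 _⊕_

_⊕_ : Vertex → Vertex → Vertex
(X ⊕ Y) k = X k xor Y k

toggleAt : ℕ → Vertex → Vertex
toggleAt i X k = does (k ≟ i) xor X k

toggleAt-at : ∀ i X → toggleAt i X i ≡ not (X i)
toggleAt-at i X = cong (_xor X i) (dec-true (i ≟ i) refl)

toggleAt-off : ∀ {i k} X → k ≢ i → toggleAt i X k ≡ X k
toggleAt-off {i} {k} X k≢i = cong (_xor X k) (dec-false (k ≟ i) k≢i)

toggleAt-cong : ∀ i {X Y} → X ≐ Y → toggleAt i X ≐ toggleAt i Y
toggleAt-cong i e k = cong (does (k ≟ i) xor_) (e k)

toggleAt-involutive : ∀ i X → toggleAt i (toggleAt i X) ≐ X
toggleAt-involutive i X k = xor-cancelˡ (does (k ≟ i)) (X k)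

toggleAt-comm : ∀ i j X → toggleAt i (toggleAt j X) ≐ toggleAt j (toggleAt i X)
toggleAt-comm i j X k = xor-swap (does (k ≟ i)) (does (k ≟ j)) (X k)

⊕-toggleAt : ∀ i X Y → X ⊕ toggleAt i Y ≐ toggleAt i (X ⊕ Y)
⊕-toggleAt i X Y k = xor-swap (X k) (does (k ≟ i)) (Y k)

toggleAt-∘ : ∀ {f : ℕ → ℕ} → (∀ {i j} → f i ≡ f j → i ≡ j) →
             ∀ i Z → (toggleAt (f i) Z ∘ f) ≐ toggleAt i (Z ∘ f)
toggleAt-∘ {f} f-injective i Z j = cong (_xor Z (f j)) same-test
  where
  same-test : does (f j ≟ f i) ≡ does (j ≟ i)
  same-test with j ≟ i
  ... | yes refl = trans (dec-true (f j ≟ f j) refl) (sym (dec-true (j ≟ j) refl))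
  ... | no  j≢i  = trans (dec-false (f j ≟ f i) (j≢i ∘ f-injective)) (sym (dec-false (j ≟ i) j≢i))

toggleAt-injective : ∀ {i j} X → toggleAt i X ≐ toggleAt j X → i ≡ j
toggleAt-injective {i} {j} X e with i ≟ j
... | yes i≡j = i≡j
... | no  i≢j = ⊥-elim (not-¬ refl (trans (sym (toggleAt-off X i≢j)) (trans (sym (e i)) (toggleAt-at i X))))

toggleAt-square : ∀ {a b d e} Z → a ≢ b → d ≢ a →
                  toggleAt d (toggleAt a Z) ≐ toggleAt e (toggleAt b Z) → d ≡ b
toggleAt-square {a} {b} {d} {e} Z a≢b d≢a square with d ≟ b | e ≟ b
... | yes d≡b | _        = d≡b
... | no  d≢b | yes refl = ⊥-elim (not-¬ refl (begin
  Z a                             ≡⟨ toggleAt-involutive e Z a ⟨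
  toggleAt e (toggleAt e Z) a     ≡⟨ square a ⟨
  toggleAt d (toggleAt a Z) a     ≡⟨ toggleAt-off (toggleAt a Z) (d≢a ∘ sym) ⟩
  toggleAt a Z a                  ≡⟨ toggleAt-at a Z ⟩
  not (Z a)                       ∎))
... | no  d≢b | no  e≢b  = ⊥-elim (not-¬ refl (begin
  Z b                             ≡⟨ toggleAt-off Z (a≢b ∘ sym) ⟨
  toggleAt a Z b                  ≡⟨ toggleAt-off (toggleAt a Z) (d≢b ∘ sym) ⟨
  toggleAt d (toggleAt a Z) b     ≡⟨ square b ⟩
  toggleAt e (toggleAt b Z) b     ≡⟨ toggleAt-off (toggleAt b Z) (e≢b ∘ sym) ⟩
  toggleAt b Z b                  ≡⟨ toggleAt-at b Z ⟩
  not (Z b)                       ∎))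

Adjacent-toggleAt : ∀ i X → Adjacent X (toggleAt i X)
Adjacent-toggleAt i X =
  i , (λ e → not-¬ refl (trans e (toggleAt-at i X))) , λ j j≢i → sym (toggleAt-off X j≢i)

Adjacent⇒≐toggleAt : ∀ {X Y} (a : Adjacent X Y) → Y ≐ toggleAt (proj₁ a) X
Adjacent⇒≐toggleAt {X} (i , Xi≢Yi , agree) k with k ≟ i
... | yes refl = trans (¬-not (Xi≢Yi ∘ sym)) (sym (toggleAt-at k X))
... | no  k≢i  = trans (sym (agree k k≢i)) (sym (toggleAt-off X k≢i))

Adjacent-sym : ∀ {X Y} → Adjacent X Y → Adjacent Y X
Adjacent-sym (i , Xi≢Yi , agree) = i , Xi≢Yi ∘ sym , λ j j≢i → sym (agree j j≢i)

Adjacent-position-unique : ∀ {X X′ Y Y′} → X ≐ X′ → Y ≐ Y′ →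
                           (a : Adjacent X Y) (a′ : Adjacent X′ Y′) → proj₁ a ≡ proj₁ a′
Adjacent-position-unique eX eY (i , Xi≢Yi , _) (i′ , _ , agree′) with i ≟ i′
... | yes i≡i′ = i≡i′
... | no  i≢i′ = ⊥-elim (Xi≢Yi (trans (eX i) (trans (agree′ i i≢i′) (sym (eY i)))))

Eventually : (ℕ → Set) → Set
Eventually P = ∃ λ N → ∀ n → n ≥ N → P n

Eventually-map : ∀ {P Q : ℕ → Set} → (∀ {n} → P n → Q n) → Eventually P → Eventually Q
Eventually-map f (N , h) = N , λ n n≥N → f (h n n≥N)

Eventually-zipWith : ∀ {P Q R : ℕ → Set} → (∀ {n} → P n → Q n → R n) →
                     Eventually P → Eventually Q → Eventually R
Eventually-zipWith f (M , g) (N , h) =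
  M ⊔ N , λ n n≥ → f (g n (≤-trans (m≤m⊔n M N) n≥)) (h n (≤-trans (m≤n⊔m M N) n≥))

image-bound : (f : ℕ → ℕ) (N : ℕ) → ∃ λ M → ∀ {k} → k < N → f k < M
image-bound f zero    = 0 , λ ()
image-bound f (suc N) with image-bound f N
... | M , bound = suc (f N) ⊔ M , λ k<1+N →
  [ (λ k<N → ≤-trans (bound k<N) (m≤n⊔m (suc (f N)) M))
  , (λ { refl → m≤m⊔n (suc (f N)) M })
  ] (m<1+n⇒m<n∨m≡n k<1+N)

Eventually-∘ : ∀ {P : ℕ → Set} (τ : Perm ℕ) → Eventually P → Eventually (P ∘ Inverse.to τ)
Eventually-∘ τ (N , h) with image-bound (Inverse.from τ) N
... | M , bound = M , λ n n≥M → h (Inverse.to τ n) (≮⇒≥ λ τn<N →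
  <⇒≱ (subst (_< M) (Inverse.strictlyInverseʳ τ n) (bound τn<N)) n≥M)

≐⇒Connected : ∀ {X Y} → X ≐ Y → Connected X Y
≐⇒Connected {X} e =
  Adjacent-toggleAt 0 X ◅ Adjacent-resp (λ _ → refl) e (Adjacent-sym (Adjacent-toggleAt 0 X)) ◅ ε

Connected-congʳ : ∀ {X Y Y′} → Connected X Y → Y ≐ Y′ → Connected X Y′
Connected-congʳ p e = p ◅◅ ≐⇒Connected e

Connected⇒Eventually : ∀ {X Y} → Connected X Y → Eventually (λ n → X n ≡ Y n)
Connected⇒Eventually ε = 0 , λ _ _ → refl
Connected⇒Eventually ((i , _ , agree) ◅ p) =
  Eventually-zipWith trans (suc i , λ n n>i → agree n λ { refl → <-irrefl refl n>i })
                           (Connected⇒Eventually p)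

Eventually⇒Connected : ∀ {X Y} → Eventually (λ n → X n ≡ Y n) → Connected X Y
Eventually⇒Connected (N , h) = go N h
  where
  go : ∀ N {X Y} → (∀ n → n ≥ N → X n ≡ Y n) → Connected X Y
  go zero    h = ≐⇒Connected λ n → h n z≤n
  go (suc N) {X} {Y} h with X N Bool.≟ Y N
  ... | yes XN≡YN = go N agree
    where
    agree : ∀ n → n ≥ N → X n ≡ Y n
    agree n n≥N with n ≟ N
    ... | yes refl = XN≡YN
    ... | no  n≢N  = h n (≤∧≢⇒< n≥N (n≢N ∘ sym))
  ... | no  XN≢YN = go N agree ◅◅ (Adjacent-sym (Adjacent-toggleAt N Y) ◅ ε)
    where
    agree : ∀ n → n ≥ N → X n ≡ toggleAt N Y n
    agree n n≥N with n ≟ N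
    ... | yes refl = trans (¬-not XN≢YN) (sym (toggleAt-at N Y))
    ... | no  n≢N  = trans (h n (≤∧≢⇒< n≥N (n≢N ∘ sym))) (sym (toggleAt-off Y n≢N))

affine : Vertex → Perm ℕ → Vertex → Vertex
affine K τ U = K ⊕ (U ∘ Inverse.from τ)

affine-cong : ∀ K τ {U V} → U ≐ V → affine K τ U ≐ affine K τ V
affine-cong K τ U≐V m = cong (K m xor_) (U≐V (Inverse.from τ m))

affine-toggleAt : ∀ K τ i U → affine K τ (toggleAt i U) ≐ toggleAt (Inverse.to τ i) (affine K τ U)
affine-toggleAt K τ i U m = begin
  K m xor toggleAt i U (from m)
    ≡⟨ cong (λ j → K m xor toggleAt j U (from m)) (strictlyInverseʳ i) ⟨
  K m xor toggleAt (from (to i)) U (from m)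
    ≡⟨ cong (K m xor_) (toggleAt-∘ from-injective (to i) U m) ⟩
  K m xor toggleAt (to i) (U ∘ from) m
    ≡⟨ ⊕-toggleAt (to i) K (U ∘ from) m ⟩
  toggleAt (to i) (affine K τ U) m
    ∎
  where
  open Inverse τ
  from-injective : ∀ {i j} → from i ≡ from j → i ≡ j
  from-injective = Injection.injective (Inverse⇒Injection (Sym.inverse τ))

affine-Adjacent : ∀ K τ {U V} → Adjacent U V → Adjacent (affine K τ U) (affine K τ V)
affine-Adjacent K τ {U} a@(i , _) =
  Adjacent-resp (λ _ → refl)
    (λ m → sym (trans (affine-cong K τ (Adjacent⇒≐toggleAt a) m) (affine-toggleAt K τ i U m)))
    (Adjacent-toggleAt (Inverse.to τ i) (affine K τ U))

affine-inverseˡ : ∀ K τ U → affine (K ∘ Inverse.to τ) (Sym.inverse τ) (affine K τ U) ≐ U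
affine-inverseˡ K τ U k =
  trans (xor-cancelˡ (K (to k)) (U (from (to k)))) (cong U (strictlyInverseʳ k))
  where open Inverse τ

affine-inverseʳ : ∀ K τ U → affine K τ (affine (K ∘ Inverse.to τ) (Sym.inverse τ) U) ≐ U
affine-inverseʳ K τ U m =
  trans (cong (λ n → K m xor (K n xor U n)) (strictlyInverseˡ m)) (xor-cancelˡ (K m) (U m))
  where open Inverse τ

affine-reflects-Adjacent : ∀ K τ {U V} → Adjacent (affine K τ U) (affine K τ V) → Adjacent U V
affine-reflects-Adjacent K τ {U} {V} a =
  Adjacent-resp (affine-inverseˡ K τ U) (affine-inverseˡ K τ V)
    (affine-Adjacent (K ∘ Inverse.to τ) (Sym.inverse τ) a)

affine-Connected : ∀ {X₀} K τ → Connected X₀ (affine K τ X₀) →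
                   ∀ {U} → Connected X₀ U → Connected X₀ (affine K τ U)
affine-Connected K τ X₀↝KX₀ X₀↝U = X₀↝KX₀ ◅◅ gmap (affine K τ) (affine-Adjacent K τ) X₀↝U

affine-inverse-Connected : ∀ {X₀} K τ → Connected X₀ (affine K τ X₀) →
                           Connected X₀ (affine (K ∘ Inverse.to τ) (Sym.inverse τ) X₀)
affine-inverse-Connected {X₀} K τ X₀↝KX₀ =
  reverse Adjacent-sym
    (Connected-congʳ (gmap _ (affine-Adjacent (K ∘ Inverse.to τ) (Sym.inverse τ)) X₀↝KX₀)
                     (affine-inverseˡ K τ X₀))

xorPerm : Bool → Perm Bool
xorPerm c = mk↔ₛ′ (c xor_) (c xor_) (xor-cancelˡ c) (xor-cancelˡ c)

Perm-Bool-xor : ∀ (p : Perm Bool) b → Inverse.to p b ≡ Inverse.to p false xor b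
Perm-Bool-xor p false = sym (xor-identityʳ _)
Perm-Bool-xor p true  = begin
  Inverse.to p true             ≡⟨ ¬-not (λ e → true≢false (Injection.injective (Inverse⇒Injection p) e)) ⟩
  not (Inverse.to p false)      ≡⟨ xor-comm true _ ⟩
  Inverse.to p false xor true   ∎
  where
  true≢false : true ≢ false
  true≢false ()

wreathTo : (ℕ → Bool) → Perm ℕ → Bool × ℕ → Bool × ℕ
wreathTo c τ (b , k) = c k xor b , Inverse.to τ k

wreathPerm : (ℕ → Bool) → Perm ℕ → Perm (Bool × ℕ)
wreathPerm c τ = Comp.inverse (type₂ (xorPerm ∘ c)) (type₁ τ)

InWeakWreath-wreathPerm : ∀ c τ → Eventually (λ n → c n ≡ false) → InWeakWreath (wreathPerm c τ)
InWeakWreath-wreathPerm c τ c-finite =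
  g-∘ (type₁ τ) (type₂ (xorPerm ∘ c)) (gen₁ τ)
    (gen₂ (xorPerm ∘ c) (Eventually-map (λ cn≡false b → cong (_xor b) cn≡false) c-finite))

record NormalForm (w : Perm (Bool × ℕ)) : Set where
  field
    shift        : ℕ → Bool
    shift-finite : Eventually (λ n → shift n ≡ false)
    perm         : Perm ℕ
    to-wreathTo  : ∀ x → Inverse.to w x ≡ wreathTo shift perm x

NormalForm-∘ : ∀ {f g} → NormalForm f → NormalForm g → NormalForm (Comp.inverse g f)
NormalForm-∘ {f} {g} nf ng = record
  { shift        = shift
  ; shift-finite = Eventually-zipWith (cong₂ _xor_) G.shift-finite (Eventually-∘ G.perm F.shift-finite)
  ; perm         = perm
  ; to-wreathTo  = to-wreathTo
  }
  where
  module F = NormalForm nf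
  module G = NormalForm ng

  shift : ℕ → Bool
  shift k = G.shift k xor F.shift (Inverse.to G.perm k)

  perm : Perm ℕ
  perm = Comp.inverse G.perm F.perm

  to-wreathTo : ∀ x → Inverse.to f (Inverse.to g x) ≡ wreathTo shift perm x
  to-wreathTo (b , k) = begin
    Inverse.to f (Inverse.to g (b , k))
      ≡⟨ cong (Inverse.to f) (G.to-wreathTo (b , k)) ⟩
    Inverse.to f (G.shift k xor b , Inverse.to G.perm k)
      ≡⟨ F.to-wreathTo _ ⟩
    (c xor (G.shift k xor b) , Inverse.to perm k)
      ≡⟨ cong (_, Inverse.to perm k) (xor-swap c (G.shift k) b) ⟩
    (G.shift k xor (c xor b) , Inverse.to perm k)
      ≡⟨ cong (_, Inverse.to perm k) (xor-assoc (G.shift k) c b) ⟨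
    wreathTo shift perm (b , k)
      ∎
    where c = F.shift (Inverse.to G.perm k)

NormalForm-⁻¹ : ∀ {f} → NormalForm f → NormalForm (Sym.inverse f)
NormalForm-⁻¹ {f} nf = record
  { shift        = shift ∘ Inverse.from perm
  ; shift-finite = Eventually-∘ (Sym.inverse perm) shift-finite
  ; perm         = Sym.inverse perm
  ; to-wreathTo  = λ { (b , m) → Inverse.inverseʳ f (sym (trans (to-wreathTo _)
      (cong₂ _,_ (xor-cancelˡ (shift (Inverse.from perm m)) b) (Inverse.strictlyInverseˡ perm m)))) }
  }
  where open NormalForm nf

normalForm : ∀ {w} → InWeakWreath w → NormalForm w
normalForm (gen₁ g) = record
  { shift = λ _ → false ; shift-finite = 0 , (λ _ _ → refl)
  ; perm = g ; to-wreathTo = λ _ → refl }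
normalForm (gen₂ i i-finite) = record
  { shift        = λ n → Inverse.to (i n) false
  ; shift-finite = Eventually-map (λ fixes → fixes false) i-finite
  ; perm         = Ident.↔-id ℕ
  ; to-wreathTo  = λ { (b , k) → cong (_, k) (Perm-Bool-xor (i k) b) }
  }
normalForm g-id = record
  { shift = λ _ → false ; shift-finite = 0 , (λ _ _ → refl)
  ; perm = Ident.↔-id ℕ ; to-wreathTo = λ _ → refl }
normalForm (g-∘ f g pf pg) = NormalForm-∘ (normalForm pf) (normalForm pg)
normalForm (g-⁻¹ f pf)     = NormalForm-⁻¹ (normalForm pf)

module AutomorphismsOf (X₀ : Vertex) where

  open Setoid (Component X₀) using () renaming (Carrier to Point; _≈_ to _≈ᶜ_)
  open Group (AutGroup X₀) using ()
    renaming (Carrier to Aut; _≈_ to _≈ᴬ_; _∙_ to _∙ᴬ_; ε to idᴬ; _⁻¹ to _⁻¹ᴬ)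

  vertex : Point → Vertex
  vertex = proj₁

  base : Point
  base = X₀ , ε

  toggleᶜ : ℕ → Point → Point
  toggleᶜ i (U , p) = toggleAt i U , p ◅◅ (Adjacent-toggleAt i U ◅ ε)

  Component-induction : (P : Point → Set) → (∀ {u v} → u ≈ᶜ v → P u → P v) → P base →
                        (∀ u i → P u → P (toggleᶜ i u)) → ∀ u → P u
  Component-induction P resp P-base P-step (U , p) = resp (λ _ → refl) (along p ε P-base)
    where
    along : ∀ {W U} (q : Star Adjacent W U) (w : Connected X₀ W) → P (W , w) → P (U , w ◅◅ q)
    along     ε       w h = resp (λ _ → refl) h
    along {W} (a ◅ q) w h = resp (λ _ → refl) (along q (w ◅◅ (a ◅ ε))
      (resp (λ k → sym (Adjacent⇒≐toggleAt a k)) (P-step (W , w) (proj₁ a) h)))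

  module Automorphism (F : Aut) where

    img : Point → Vertex
    img u = proj₁ (Inverse.to (proj₁ F) u)

    img-cong : ∀ {u v} → u ≈ᶜ v → img u ≐ img v
    img-cong = Inverse.to-cong (proj₁ F)

    img-injective : ∀ {u v} → img u ≐ img v → u ≈ᶜ v
    img-injective = Injection.injective (Inverse⇒Injection (proj₁ F))

    preserves : ∀ u v → Adjacent (vertex u) (vertex v) → Adjacent (img u) (img v)
    preserves u v = Equivalence.to (proj₂ F u v)

    direction : Point → ℕ → ℕ
    direction u i = proj₁ (preserves u (toggleᶜ i u) (Adjacent-toggleAt i (vertex u)))

    img-toggleAt-direction : ∀ u i → img (toggleᶜ i u) ≐ toggleAt (direction u i) (img u)
    img-toggleAt-direction u i = Adjacent⇒≐toggleAt (preserves u (toggleᶜ i u) _)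

    direction-cong : ∀ {u v} i → u ≈ᶜ v → direction u i ≡ direction v i
    direction-cong {u} {v} i u≈v =
      Adjacent-position-unique (img-cong u≈v) (img-cong {toggleᶜ i u} {toggleᶜ i v} (toggleAt-cong i u≈v))
        (preserves u (toggleᶜ i u) _) (preserves v (toggleᶜ i v) _)

    direction-injective : ∀ u {i j} → direction u i ≡ direction u j → i ≡ j
    direction-injective u {i} {j} same = toggleAt-injective (vertex u) (img-injective λ k → begin
      img (toggleᶜ i u) k                ≡⟨ img-toggleAt-direction u i k ⟩
      toggleAt (direction u i) (img u) k ≡⟨ cong (λ d → toggleAt d (img u) k) same ⟩
      toggleAt (direction u j) (img u) k ≡⟨ img-toggleAt-direction u j k ⟨
      img (toggleᶜ j u) k                ∎)

    direction-toggleAt : ∀ u i → direction (toggleᶜ i u) i ≡ direction u i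
    direction-toggleAt u i =
      Adjacent-position-unique (λ _ → refl)
        (img-cong {toggleᶜ i (toggleᶜ i u)} {u} (toggleAt-involutive i (vertex u)))
        (preserves (toggleᶜ i u) (toggleᶜ i (toggleᶜ i u)) _)
        (Adjacent-sym (preserves u (toggleᶜ i u) _))

    σ : ℕ → ℕ
    σ = direction base

    DirectionsAgree : Point → Set
    DirectionsAgree u = ∀ i → direction u i ≡ σ i

    img-toggleAt-agree : ∀ {u} → DirectionsAgree u → ∀ i → img (toggleᶜ i u) ≐ toggleAt (σ i) (img u)
    img-toggleAt-agree {u} agree i k =
      trans (img-toggleAt-direction u i k) (cong (λ d → toggleAt d (img u) k) (agree i))

    -- The two paths around the square u, toggleᶜ i u, toggleᶜ j u, toggleᶜ i (toggleᶜ j u)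
    -- have the same image, which forces the directions of opposite sides to coincide.
    DirectionsAgree-toggleAt : ∀ u i → DirectionsAgree u → DirectionsAgree (toggleᶜ i u)
    DirectionsAgree-toggleAt u i agree j with j ≟ i
    ... | yes refl = trans (direction-toggleAt u j) (agree j)
    ... | no  j≢i  = toggleAt-square (img u) σi≢σj d≢σi square
      where
      v  = toggleᶜ i u
      uj = toggleᶜ j u
      d  = direction v j
      e  = direction uj i

      σi≢σj : σ i ≢ σ j
      σi≢σj σi≡σj = j≢i (sym (direction-injective u (trans (agree i) (trans σi≡σj (sym (agree j))))))

      d≢σi : d ≢ σ i
      d≢σi d≡σi = j≢i (direction-injective v (trans d≡σi (sym (trans (direction-toggleAt u i) (agree i)))))

      square : toggleAt d (toggleAt (σ i) (img u)) ≐ toggleAt e (toggleAt (σ j) (img u))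
      square k = begin
        toggleAt d (toggleAt (σ i) (img u)) k ≡⟨ toggleAt-cong d (img-toggleAt-agree agree i) k ⟨
        toggleAt d (img v) k                  ≡⟨ img-toggleAt-direction v j k ⟨
        img (toggleᶜ j v) k                   ≡⟨ img-cong {toggleᶜ j v} {toggleᶜ i uj}
                                                   (toggleAt-comm j i (vertex u)) k ⟩
        img (toggleᶜ i uj) k                  ≡⟨ img-toggleAt-direction uj i k ⟩
        toggleAt e (img uj) k                 ≡⟨ toggleAt-cong e (img-toggleAt-agree agree j) k ⟩
        toggleAt e (toggleAt (σ j) (img u)) k ∎

    directions-agree : ∀ u → DirectionsAgree u
    directions-agree =
      Component-induction DirectionsAgree
        (λ u≈v agree i → trans (sym (direction-cong i u≈v)) (agree i))
        (λ _ → refl) DirectionsAgree-toggleAt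

    img-toggleAt : ∀ u i → img (toggleᶜ i u) ≐ toggleAt (σ i) (img u)
    img-toggleAt u = img-toggleAt-agree (directions-agree u)

    σ-injective : ∀ {i j} → σ i ≡ σ j → i ≡ j
    σ-injective = direction-injective base

    position-image : ∀ u v (a : Adjacent (vertex u) (vertex v)) → proj₁ (preserves u v a) ≡ σ (proj₁ a)
    position-image u v a@(i , _) = trans
      (Adjacent-position-unique (λ _ → refl)
        (img-cong {v} {toggleᶜ i u} (Adjacent⇒≐toggleAt a)) (preserves u v a) (preserves u (toggleᶜ i u) _))
      (directions-agree u i)

    translation : Vertex
    translation = X₀ ⊕ img base

    IsAffineAt : Point → Set
    IsAffineAt u = ∀ j → (X₀ ⊕ img u) (σ j) ≡ translation (σ j) xor (X₀ ⊕ vertex u) j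

    IsAffineAt-cong : ∀ {u v} → u ≈ᶜ v → IsAffineAt u → IsAffineAt v
    IsAffineAt-cong {u} {v} u≈v affine j = begin
      (X₀ ⊕ img v) (σ j)                        ≡⟨ cong (X₀ (σ j) xor_) (img-cong u≈v (σ j)) ⟨
      (X₀ ⊕ img u) (σ j)                        ≡⟨ affine j ⟩
      translation (σ j) xor (X₀ ⊕ vertex u) j   ≡⟨ cong (λ U → translation (σ j) xor (X₀ j xor U)) (u≈v j) ⟩
      translation (σ j) xor (X₀ ⊕ vertex v) j   ∎

    IsAffineAt-toggleAt : ∀ u i → IsAffineAt u → IsAffineAt (toggleᶜ i u)
    IsAffineAt-toggleAt u i affine j = begin
      (X₀ ⊕ img (toggleᶜ i u)) (σ j)
        ≡⟨ cong (X₀ (σ j) xor_) (img-toggleAt u i (σ j)) ⟩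
      (X₀ ⊕ toggleAt (σ i) (img u)) (σ j)
        ≡⟨ ⊕-toggleAt (σ i) X₀ (img u) (σ j) ⟩
      toggleAt (σ i) (X₀ ⊕ img u) (σ j)
        ≡⟨ toggleAt-∘ σ-injective i (X₀ ⊕ img u) j ⟩
      toggleAt i ((X₀ ⊕ img u) ∘ σ) j
        ≡⟨ toggleAt-cong i affine j ⟩
      toggleAt i ((translation ∘ σ) ⊕ (X₀ ⊕ vertex u)) j
        ≡⟨ ⊕-toggleAt i (translation ∘ σ) (X₀ ⊕ vertex u) j ⟨
      translation (σ j) xor toggleAt i (X₀ ⊕ vertex u) j
        ≡⟨ cong (translation (σ j) xor_) (⊕-toggleAt i X₀ (vertex u) j) ⟨
      translation (σ j) xor (X₀ ⊕ toggleAt i (vertex u)) j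
        ∎

    img-affine : ∀ u → IsAffineAt u
    img-affine = Component-induction IsAffineAt IsAffineAt-cong
      (λ j → sym (trans (cong (translation (σ j) xor_) (xor-same (X₀ j))) (xor-identityʳ _)))
      IsAffineAt-toggleAt

  open Automorphism public using (img; preserves; σ; translation; img-affine; position-image)

  σ-∙ : ∀ F H k → σ (F ∙ᴬ H) k ≡ σ F (σ H k)
  σ-∙ F H k = position-image F (Inverse.to (proj₁ H) base) (Inverse.to (proj₁ H) (toggleᶜ k base))
    (preserves H base (toggleᶜ k base) (Adjacent-toggleAt k X₀))

  σ-cong : ∀ {F H} → F ≈ᴬ H → ∀ k → σ F k ≡ σ H k
  σ-cong {F} {H} F≈H k = Adjacent-position-unique (F≈H base) (F≈H (toggleᶜ k base))
    (preserves F base (toggleᶜ k base) _) (preserves H base (toggleᶜ k base) _)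

  σ-inverseʳ : ∀ F k → σ F (σ (F ⁻¹ᴬ) k) ≡ k
  σ-inverseʳ F k =
    trans (sym (σ-∙ F (F ⁻¹ᴬ) k)) (σ-cong {F ∙ᴬ F ⁻¹ᴬ} {idᴬ} (Group.inverseʳ (AutGroup X₀) F) k)

  σ-inverseˡ : ∀ F k → σ (F ⁻¹ᴬ) (σ F k) ≡ k
  σ-inverseˡ F k =
    trans (sym (σ-∙ (F ⁻¹ᴬ) F k)) (σ-cong {F ⁻¹ᴬ ∙ᴬ F} {idᴬ} (Group.inverseˡ (AutGroup X₀) F) k)

  σ-perm : Aut → Perm ℕ
  σ-perm F = mk↔ₛ′ (σ F) (σ (F ⁻¹ᴬ)) (σ-inverseʳ F) (σ-inverseˡ F)

  translation-∙ : ∀ F H j → translation (F ∙ᴬ H) (σ F j) ≡ translation F (σ F j) xor translation H j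
  translation-∙ F H = img-affine F (Inverse.to (proj₁ H) base)

  translation-cong : ∀ {F H} → F ≈ᴬ H → translation F ≐ translation H
  translation-cong F≈H m = cong (X₀ m xor_) (F≈H base m)

  translation-finite : ∀ F → Eventually (λ n → translation F n ≡ false)
  translation-finite F =
    Eventually-map (λ {n} X₀n≡ → trans (cong (X₀ n xor_) (sym X₀n≡)) (xor-same (X₀ n)))
      (Connected⇒Eventually (proj₂ (Inverse.to (proj₁ F) base)))

  determined-by-σ-translation : ∀ F H → (∀ k → σ F k ≡ σ H k) →
                                (∀ k → translation F (σ F k) ≡ translation H (σ H k)) → F ≈ᴬ H
  determined-by-σ-translation F H σ≡ translation≡ u m =
    subst (λ m → img F u m ≡ img H u m) (σ-inverseʳ F m) (agree (σ (F ⁻¹ᴬ) m))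
    where
    agree : ∀ j → img F u (σ F j) ≡ img H u (σ F j)
    agree j = xor-injective (X₀ (σ F j)) (begin
      (X₀ ⊕ img F u) (σ F j)                        ≡⟨ img-affine F u j ⟩
      translation F (σ F j) xor (X₀ ⊕ vertex u) j   ≡⟨ cong (_xor (X₀ ⊕ vertex u) j) (translation≡ j) ⟩
      translation H (σ H j) xor (X₀ ⊕ vertex u) j   ≡⟨ img-affine H u j ⟨
      (X₀ ⊕ img H u) (σ H j)                        ≡⟨ cong (X₀ ⊕ img H u) (σ≡ j) ⟨
      (X₀ ⊕ img H u) (σ F j)                        ∎)

  module Realization (c : ℕ → Bool) (c-finite : Eventually (λ n → c n ≡ false)) (τ : Perm ℕ) where

    -- Relative to X₀, the realized map sends X₀ ⊕ U to (c ⊕ X₀ ⊕ U) ∘ τ⁻¹.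
    K : Vertex
    K = X₀ ⊕ ((c ⊕ X₀) ∘ Inverse.from τ)

    affine-X₀ : ∀ n → affine K τ X₀ n ≡ X₀ n xor c (Inverse.from τ n)
    affine-X₀ n = trans (xor-assoc (X₀ n) _ _) (cong (X₀ n xor_) (xor-cancelʳ _ _))

    X₀↝KX₀ : Connected X₀ (affine K τ X₀)
    X₀↝KX₀ = Eventually⇒Connected (Eventually-map
      (λ {n} cn′≡false → sym (trans (affine-X₀ n) (trans (cong (X₀ n xor_) cn′≡false) (xor-identityʳ _))))
      (Eventually-∘ (Sym.inverse τ) c-finite))

    realize : Aut
    realize = record
      { to        = λ { (U , p) → affine K τ U , affine-Connected K τ X₀↝KX₀ p }
      ; from      = λ { (U , p) →
          affine K′ τ′ U , affine-Connected K′ τ′ (affine-inverse-Connected K τ X₀↝KX₀) p }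
      ; to-cong   = affine-cong K τ
      ; from-cong = affine-cong K′ τ′
      ; inverse   = (λ {x} y≈ m → trans (affine-cong K τ y≈ m) (affine-inverseʳ K τ (vertex x) m))
                  , (λ {x} y≈ k → trans (affine-cong K′ τ′ y≈ k) (affine-inverseˡ K τ (vertex x) k))
      }
      , λ _ _ → mk⇔ (affine-Adjacent K τ) (affine-reflects-Adjacent K τ)
      where
      K′ = K ∘ Inverse.to τ
      τ′ = Sym.inverse τ

    translation-realize : ∀ k → translation realize (Inverse.to τ k) ≡ c k
    translation-realize k = begin
      X₀ n xor affine K τ X₀ n                 ≡⟨ cong (X₀ n xor_) (affine-X₀ n) ⟩
      X₀ n xor (X₀ n xor c (Inverse.from τ n)) ≡⟨ xor-cancelˡ (X₀ n) _ ⟩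
      c (Inverse.from τ n)                     ≡⟨ cong c (Inverse.strictlyInverseʳ τ k) ⟩
      c k                                      ∎
      where n = Inverse.to τ k

module WreathRepresentation (X₀ : Vertex) where

  open AutomorphismsOf X₀
  open Group (AutGroup X₀) using ()
    renaming (Carrier to Aut; _≈_ to _≈ᴬ_; _∙_ to _∙ᴬ_; ε to idᴬ; _⁻¹ to _⁻¹ᴬ)
  module W = Group WeakWreathS₂Sℵ₀
  open W using () renaming (Carrier to Wreath; _≈_ to _≈ᵂ_; _∙_ to _∙ᵂ_; ε to idᵂ; _⁻¹ to _⁻¹ᵂ)

  φ : Aut → Wreath
  φ F = wreathPerm (translation F ∘ σ F) (σ-perm F)
      , InWeakWreath-wreathPerm (translation F ∘ σ F) (σ-perm F)
          (Eventually-∘ (σ-perm F) (translation-finite F))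

  φ-cong : ∀ {F H} → F ≈ᴬ H → φ F ≈ᵂ φ H
  φ-cong {F} {H} F≈H (b , k) = cong₂ _,_
    (cong (_xor b) (trans (cong (translation F) σF≡σH) (translation-cong {F} {H} F≈H (σ H k))))
    σF≡σH
    where
    σF≡σH : σ F k ≡ σ H k
    σF≡σH = σ-cong {F} {H} F≈H k

  φ-homo : ∀ F H → φ (F ∙ᴬ H) ≈ᵂ (φ F ∙ᵂ φ H)
  φ-homo F H (b , k) = cong₂ _,_
    (begin
      translation (F ∙ᴬ H) (σ (F ∙ᴬ H) k) xor b
        ≡⟨ cong (λ i → translation (F ∙ᴬ H) i xor b) (σ-∙ F H k) ⟩
      translation (F ∙ᴬ H) (σ F j) xor b
        ≡⟨ cong (_xor b) (translation-∙ F H j) ⟩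
      (translation F (σ F j) xor translation H j) xor b
        ≡⟨ xor-assoc (translation F (σ F j)) (translation H j) b ⟩
      translation F (σ F j) xor (translation H j xor b)
        ∎)
    (σ-∙ F H k)
    where j = σ H k

  φ-ε : φ idᴬ ≈ᵂ idᵂ
  φ-ε (b , k) = cong (λ t → t xor b , k) (xor-same (X₀ k))

  φ-⁻¹ : ∀ F → φ (F ⁻¹ᴬ) ≈ᵂ (φ F) ⁻¹ᵂ
  φ-⁻¹ F = inverseˡ-unique (φ (F ⁻¹ᴬ)) (φ F)
    (W.trans {φ (F ⁻¹ᴬ) ∙ᵂ φ F} {φ (F ⁻¹ᴬ ∙ᴬ F)} {idᵂ}
      (W.sym {φ (F ⁻¹ᴬ ∙ᴬ F)} {φ (F ⁻¹ᴬ) ∙ᵂ φ F} (φ-homo (F ⁻¹ᴬ) F))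
      (W.trans {φ (F ⁻¹ᴬ ∙ᴬ F)} {φ idᴬ} {idᵂ}
        (φ-cong {F ⁻¹ᴬ ∙ᴬ F} {idᴬ} (Group.inverseˡ (AutGroup X₀) F)) φ-ε))
    where open import Algebra.Properties.Group WeakWreathS₂Sℵ₀ using (inverseˡ-unique)

  φ-injective : ∀ {F H} → φ F ≈ᵂ φ H → F ≈ᴬ H
  φ-injective {F} {H} φF≈φH = determined-by-σ-translation F H (λ k → cong proj₂ (at k)) λ k →
    trans (sym (xor-identityʳ _)) (trans (cong proj₁ (at k)) (xor-identityʳ _))
    where
    at : ∀ k → Inverse.to (proj₁ (φ F)) (false , k) ≡ Inverse.to (proj₁ (φ H)) (false , k)
    at k = φF≈φH (false , k)

  φ-surjective : ∀ w → ∃ λ F → ∀ {H} → H ≈ᴬ F → φ H ≈ᵂ w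
  φ-surjective (w , w∈) =
    realize , λ {H} H≈realize x → trans (φ-cong {H} {realize} H≈realize x) (φ-realize x)
    where
    open NormalForm (normalForm w∈)
    open Realization shift shift-finite perm
    -- σ realize k reduces to Inverse.to perm k: affine-Adjacent moves position i to Inverse.to perm i.
    φ-realize : ∀ x → Inverse.to (proj₁ (φ realize)) x ≡ Inverse.to w x
    φ-realize (b , k) =
      trans (cong (λ t → t xor b , Inverse.to perm k) (translation-realize k)) (sym (to-wreathTo (b , k)))

corollary1 : (X₀ : Vertex) → AutGroup X₀ ≅ᴳ WeakWreathS₂Sℵ₀
corollary1 X₀ = φ , record
  { isGroupMonomorphism = record
    { isGroupHomomorphism = record
      { isMonoidHomomorphism = record
        { isMagmaHomomorphism = record
          { isRelHomomorphism = record { cong = λ {F} {H} → φ-cong {F} {H} }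
          ; homo              = φ-homo
          }
        ; ε-homo = φ-ε
        }
      ; ⁻¹-homo = φ-⁻¹
      }
    ; injective = λ {F} {H} → φ-injective {F} {H}
    }
  ; surjective = φ-surjective
  }
  where open WreathRepresentation X₀
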